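{- For $n\geq 0$ let $A_n(x,y)=\sum_{i,j\geq 0}|\mathcal{A}_{i,j}(n)|\,x^iy^j$. Then $$A_n(x,y)=\prod_{i=0}^{n-1}(x+y+i).$$
   Context: A shape of length $n$ is a Ferrers diagram in English notation (possibly with empty rows or columns), determined by its south-east border, a path of $n$ unit south/west steps from the top-right to the bottom-left corner; south steps correspond to rows, west steps to columns. An alternative tableau is a shape with a partial filling of cells by left arrows and up arrows such that every cell to the left of a left arrow in its row, and every cell above an up arrow in its column, is empty. Its length is that of its shape. A free row is a row with no left arrow; a free column is a column with no up arrow. $\mathcal{A}_{i,j}(n)$ is the set of alternative tableaux of length $n$ with exactly $i$ free rows and $j$ free columns. -}

module Defs where

open import Level using (Level)
open import Data.Bool using (Bool; true; false; _∧_; _∨_; not; if_then_else_)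
open import Data.Nat using (ℕ; zero; suc; _<ᵇ_)
import Data.Nat as ℕ
open import Data.Fin using (Fin; toℕ)
import Data.Fin as Fin
open import Data.Maybe using (Maybe; just; nothing; is-nothing)
open import Data.Vec using (Vec; lookup)
open import Data.Product using (Σ; _×_)
open import Relation.Binary.PropositionalEquality using (_≡_)
open import Algebra.Bundles using (CommutativeSemiring)

allFin : ∀ {n} → (Fin n → Bool) → Bool
allFin {zero}  f = true
allFin {suc n} f = f Fin.zero ∧ allFin (λ k → f (Fin.suc k))

anyFin : ∀ {n} → (Fin n → Bool) → Bool
anyFin {zero}  f = false
anyFin {suc n} f = f Fin.zero ∨ anyFin (λ k → f (Fin.suc k))

countFin : ∀ {n} → (Fin n → Bool) → ℕ
countFin {zero}  f = 0
countFin {suc n} f = (if f Fin.zero then 1 else 0) ℕ.+ countFin (λ k → f (Fin.suc k))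

-- A shape of length n: its south-east border path, read from the top-right
-- corner to the bottom-left corner.  Step k is  true  = south step (a row),
-- false = west step (a column).  Rows are identified with the indices of
-- south steps, columns with the indices of west steps.  The cell in row k
-- and column l belongs to the diagram iff k < l (the west step of column l
-- comes after the south step of row k).  Rows further down have larger
-- indices; columns further left have larger indices.
Shape : ℕ → Set
Shape n = Vec Bool n

isRow : ∀ {n} → Shape n → Fin n → Bool
isRow s k = lookup s k

isCol : ∀ {n} → Shape n → Fin n → Bool
isCol s l = not (lookup s l)

isCell : ∀ {n} → Shape n → Fin n → Fin n → Bool
isCell s k l = isRow s k ∧ isCol s l ∧ (toℕ k <ᵇ toℕ l)

data Arrow : Set where
  left up : Arrow

isLeft : Maybe Arrow → Bool
isLeft (just left) = true
isLeft _           = false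

isUp : Maybe Arrow → Bool
isUp (just up) = true
isUp _         = false

Filling : ℕ → Set
Filling n = Vec (Vec (Maybe Arrow) n) n

entry : ∀ {n} → Filling n → Fin n → Fin n → Maybe Arrow
entry F k l = lookup (lookup F k) l

_⇒ᵇ_ : Bool → Bool → Bool
a ⇒ᵇ b = not a ∨ b

-- Validity of an alternative tableau (shape s, filling F):
--  * only cells of the diagram are filled;
--  * every cell to the left of a left arrow in its row is empty
--    (column l' is left of column l iff l < l');
--  * every cell above an up arrow in its column is empty
--    (row k' is above row k iff k' < k).
isAltTableau : ∀ {n} → Shape n → Filling n → Bool
isAltTableau s F =
  allFin (λ k → allFin (λ l →
      (not (is-nothing (entry F k l)) ⇒ᵇ isCell s k l)
    ∧ (isLeft (entry F k l) ⇒ᵇ allFin (λ l' →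
          (toℕ l <ᵇ toℕ l') ⇒ᵇ is-nothing (entry F k l')))
    ∧ (isUp (entry F k l) ⇒ᵇ allFin (λ k' →
          (toℕ k' <ᵇ toℕ k) ⇒ᵇ is-nothing (entry F k' l)))))

freeRows : ∀ {n} → Shape n → Filling n → ℕ
freeRows s F = countFin (λ k → isRow s k ∧ not (anyFin (λ l → isLeft (entry F k l))))

freeCols : ∀ {n} → Shape n → Filling n → ℕ
freeCols s F = countFin (λ l → isCol s l ∧ not (anyFin (λ k → isUp (entry F k l))))

record AltTableau (n : ℕ) : Set where
  constructor mkAT
  field
    shape   : Shape n
    filling : Filling n
    valid   : isAltTableau shape filling ≡ true

open AltTableau public

𝒜 : ℕ → ℕ → ℕ → Set
𝒜 i j n = Σ (AltTableau n) λ T →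
  (freeRows (shape T) (filling T) ≡ i) × (freeCols (shape T) (filling T) ≡ j)

module SemiringOps {a ℓ : Level} (R : CommutativeSemiring a ℓ) where
  open CommutativeSemiring R

  ∑ : ∀ {n} → (Fin n → Carrier) → Carrier
  ∑ {zero}  f = 0#
  ∑ {suc n} f = f Fin.zero + ∑ (λ k → f (Fin.suc k))

  ∏ : ∀ {n} → (Fin n → Carrier) → Carrier
  ∏ {zero}  f = 1#
  ∏ {suc n} f = f Fin.zero * ∏ (λ k → f (Fin.suc k))

  ⟦_⟧ : ℕ → Carrier
  ⟦ zero ⟧  = 0#
  ⟦ suc m ⟧ = 1# + ⟦ m ⟧

  _^_ : Carrier → ℕ → Carrier
  x ^ zero  = 1#
  x ^ suc m = x * (x ^ m)

module Submission where

-- Idea.  Delete the first step of the border path of a tableau of length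
-- n+1.  If it is a west step, it is an empty column at the far right: the
-- tableau is a tableau T of length n plus one new free column.  If it is a
-- south step, it is a new top row lying over every column of T; it can only
-- carry arrows in the free columns of T (an up arrow below forbids anything
-- above it), and apart from that it is any row whose left arrow, if any, is
-- its leftmost filled cell.  If T has m free columns, the new column
-- (weight y^(m+1)) and the new top rows together contribute (x+y)(1+y)^m
-- times the weight of T (lemma topRow-sum), so that
--
--   A_{n+1}(x,y) = (x+y) A_n(x, 1+y),
--
-- and the product formula follows by induction on n.

open import Defs
open import Level using (0ℓ)
open import Data.Bool using (Bool; true; false; _∧_; _∨_; not; if_then_else_)
import Data.Bool as Bool
import Data.Bool.Properties as BoolP
open import Data.Nat using (ℕ; zero; suc; _≤_; z≤n; s≤s; _<ᵇ_; _≟_) renaming (_+_ to _+ℕ_)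
import Data.Nat.Properties as ℕP
open import Data.Fin using (Fin; toℕ; fromℕ<; splitAt)
import Data.Fin as F
open import Data.Fin.Properties using (+↔⊎; toℕ-fromℕ<; toℕ-injective; suc-injective)
open import Data.Vec using (Vec; []; _∷_; lookup; map; tail; replicate)
open import Data.Vec.Properties using (lookup-map; lookup-replicate)
open import Data.Maybe using (Maybe; just; nothing; is-nothing)
open import Data.Empty using (⊥; ⊥-elim)
open import Data.Unit using (⊤; tt)
open import Data.Sum using (_⊎_; inj₁; inj₂)
import Data.Sum as Sum
open import Data.Product using (Σ; _×_; _,_; proj₁; proj₂)
open import Data.Product.Function.Dependent.Propositional using (Σ-↔)
open import Data.Sum.Function.Propositional using (_⊎-↔_)
open import Function.Bundles using (_↔_; Inverse; mk↔ₛ′)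
open import Function.Properties.Inverse using (↔-trans; ↔-refl)
open import Relation.Nullary using (Dec; yes; no; ¬_; Irrelevant)
open import Relation.Nullary.Decidable using (_×-dec_)
open import Relation.Binary.PropositionalEquality
  using (_≡_; refl; cong; cong₂; sym; trans)
open import Axiom.UniquenessOfIdentityProofs using (module Decidable⇒UIP)
open import Algebra.Bundles using (CommutativeSemiring)

open Inverse using (to)

∧-elim : ∀ {a b} → a ∧ b ≡ true → (a ≡ true) × (b ≡ true)
∧-elim {true} {true} _ = refl , refl

∧-intro : ∀ {a b} → a ≡ true → b ≡ true → a ∧ b ≡ true
∧-intro refl refl = refl

⇒ᵇ-elim : ∀ {a b} → (a ⇒ᵇ b) ≡ true → a ≡ true → b ≡ true
⇒ᵇ-elim {true} {true} _ _ = refl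

⇒ᵇ-intro : ∀ {a b} → (a ≡ true → b ≡ true) → (a ⇒ᵇ b) ≡ true
⇒ᵇ-intro {true}  f = f refl
⇒ᵇ-intro {false} f = refl

not-intro : ∀ {b} → b ≡ false → not b ≡ true
not-intro refl = refl

not-elim : ∀ {b} → not b ≡ true → b ≡ false
not-elim {false} _ = refl

true≢false : true ≡ false → ⊥
true≢false ()

-- Proofs of b ≡ true are unique; this makes validity proofs irrelevant.
bool-UIP : ∀ {a b : Bool} (p q : a ≡ b) → p ≡ q
bool-UIP = Decidable⇒UIP.≡-irrelevant Bool._≟_

allFin-elim : ∀ {n} {f : Fin n → Bool} → allFin f ≡ true → ∀ k → f k ≡ true
allFin-elim {suc n} {f} p F.zero    = proj₁ (∧-elim {f F.zero} p)
allFin-elim {suc n} {f} p (F.suc k) = allFin-elim (proj₂ (∧-elim {f F.zero} p)) k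

allFin-intro : ∀ {n} {f : Fin n → Bool} → (∀ k → f k ≡ true) → allFin f ≡ true
allFin-intro {zero}  h = refl
allFin-intro {suc n} h = ∧-intro (h F.zero) (allFin-intro (λ k → h (F.suc k)))

anyFin-witness : ∀ {n} {f : Fin n → Bool} k → f k ≡ true → anyFin f ≡ true
anyFin-witness {suc n} {f} F.zero p rewrite p = refl
anyFin-witness {suc n} {f} (F.suc k) p with f F.zero
... | true  = refl
... | false = anyFin-witness k p

anyFin-none : ∀ {n} {f : Fin n → Bool} → (∀ k → f k ≡ false) → anyFin f ≡ false
anyFin-none {zero}  h = refl
anyFin-none {suc n} {f} h rewrite h F.zero = anyFin-none (λ k → h (F.suc k))

anyFin-cong : ∀ {n} {f g : Fin n → Bool} → (∀ k → f k ≡ g k) → anyFin f ≡ anyFin g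
anyFin-cong {zero}  h = refl
anyFin-cong {suc n} h rewrite h F.zero = cong (_ ∨_) (anyFin-cong (λ k → h (F.suc k)))

countFin-cong : ∀ {n} {f g : Fin n → Bool} → (∀ k → f k ≡ g k) → countFin f ≡ countFin g
countFin-cong {zero}  h = refl
countFin-cong {suc n} h rewrite h F.zero = cong (_ +ℕ_) (countFin-cong (λ k → h (F.suc k)))

-- A count over Fin n is at most n; hence the statistics are bounded by n.
countFin-≤ : ∀ {n} (f : Fin n → Bool) → countFin f ≤ n
countFin-≤ {zero}  f = z≤n
countFin-≤ {suc n} f with f F.zero
... | true  = s≤s (countFin-≤ _)
... | false = ℕP.m≤n⇒m≤1+n (countFin-≤ _)

bit : Bool → ℕ
bit b = if b then 1 else 0

record Enum (A : Set) : Set where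
  constructor enumeration
  field
    size     : ℕ
    elements : Fin size ↔ A

  element : Fin size → A
  element = to elements

open Enum public

_▷_ : ∀ {A B : Set} → Enum A → A ↔ B → Enum B
E ▷ g = enumeration (size E) (↔-trans (elements E) g)

⊤-enum : Enum ⊤
⊤-enum = enumeration 1 (mk↔ₛ′ (λ _ → tt) (λ _ → F.zero) (λ _ → refl) (λ { F.zero → refl ; (F.suc ()) }))

_⊕_ : ∀ {A B : Set} → Enum A → Enum B → Enum (A ⊎ B)
E₁ ⊕ E₂ = enumeration (size E₁ +ℕ size E₂) (↔-trans +↔⊎ (elements E₁ ⊎-↔ elements E₂))

decidable-enum : ∀ {P : Set} → Irrelevant P → Dec P → Enum P
decidable-enum irr (yes p) = enumeration 1 (mk↔ₛ′ (λ _ → p) (λ _ → F.zero) (irr p) (λ { F.zero → refl ; (F.suc ()) }))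
decidable-enum irr (no ¬p) = enumeration 0 (mk↔ₛ′ (λ ()) (λ p → ⊥-elim (¬p p)) (λ p → ⊥-elim (¬p p)) (λ ()))

Σ-Fin-suc-↔ : ∀ {m} (Q : Fin (suc m) → Set) →
  (Q F.zero ⊎ Σ (Fin m) (λ k → Q (F.suc k))) ↔ Σ (Fin (suc m)) Q
Σ-Fin-suc-↔ Q = mk↔ₛ′ join split join-split split-join
  where
  join : Q F.zero ⊎ Σ (Fin _) (λ k → Q (F.suc k)) → Σ (Fin (suc _)) Q
  join (inj₁ q)       = F.zero , q
  join (inj₂ (k , q)) = F.suc k , q
  split : Σ (Fin (suc _)) Q → Q F.zero ⊎ Σ (Fin _) (λ k → Q (F.suc k))
  split (F.zero , q)  = inj₁ q
  split (F.suc k , q) = inj₂ (k , q)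
  join-split : ∀ x → join (split x) ≡ x
  join-split (F.zero , q)  = refl
  join-split (F.suc k , q) = refl
  split-join : ∀ x → split (join x) ≡ x
  split-join (inj₁ q)       = refl
  split-join (inj₂ (k , q)) = refl

Σ-Fin-enum : ∀ m (Q : Fin m → Set) → (∀ k → Enum (Q k)) → Enum (Σ (Fin m) Q)
Σ-Fin-enum zero    Q E = enumeration 0 (mk↔ₛ′ (λ ()) (λ { (() , _) }) (λ { (() , _) }) (λ ()))
Σ-Fin-enum (suc m) Q E =
  (E F.zero ⊕ Σ-Fin-enum m (λ k → Q (F.suc k)) (λ k → E (F.suc k))) ▷ Σ-Fin-suc-↔ Q

Σ-enum : ∀ {A : Set} (EA : Enum A) (B : A → Set) → (∀ a → Enum (B a)) → Enum (Σ A B)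
Σ-enum EA B EB =
  Σ-Fin-enum (size EA) (λ k → B (element EA k)) (λ k → EB (element EA k))
    ▷ Σ-↔ (elements EA) ↔-refl

module Sums (R : CommutativeSemiring 0ℓ 0ℓ) where
  open CommutativeSemiring R renaming (refl to refl≈; sym to sym≈; trans to trans≈)
  open SemiringOps R
  open import Relation.Binary.Reasoning.Setoid setoid
  open import Algebra.Solver.Ring.NaturalCoefficients.Default R using (solve; _:+_; _:*_; _:=_)

  ≡⇒≈ : ∀ {a b : Carrier} → a ≡ b → a ≈ b
  ≡⇒≈ refl = refl≈

  ∑-cong : ∀ {n} {f g : Fin n → Carrier} → (∀ k → f k ≈ g k) → ∑ f ≈ ∑ g
  ∑-cong {zero}  h = refl≈
  ∑-cong {suc n} h = +-cong (h F.zero) (∑-cong (λ k → h (F.suc k)))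

  ∏-cong : ∀ {n} {f g : Fin n → Carrier} → (∀ k → f k ≈ g k) → ∏ f ≈ ∏ g
  ∏-cong {zero}  h = refl≈
  ∏-cong {suc n} h = *-cong (h F.zero) (∏-cong (λ k → h (F.suc k)))

  ∑-+ : ∀ {n} (f g : Fin n → Carrier) → ∑ (λ k → f k + g k) ≈ ∑ f + ∑ g
  ∑-+ {zero}  f g = sym≈ (+-identityˡ 0#)
  ∑-+ {suc n} f g = begin
    (f F.zero + g F.zero) + ∑ (λ k → f (F.suc k) + g (F.suc k))
      ≈⟨ +-congˡ (∑-+ (λ k → f (F.suc k)) (λ k → g (F.suc k))) ⟩
    (f F.zero + g F.zero) + (∑ (λ k → f (F.suc k)) + ∑ (λ k → g (F.suc k)))
      ≈⟨ solve 4 (λ a b c d → (a :+ b) :+ (c :+ d) := (a :+ c) :+ (b :+ d)) refl≈ _ _ _ _ ⟩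
    (f F.zero + ∑ (λ k → f (F.suc k))) + (g F.zero + ∑ (λ k → g (F.suc k))) ∎

  ∑-*ˡ : ∀ {n} c (f : Fin n → Carrier) → ∑ (λ k → c * f k) ≈ c * ∑ f
  ∑-*ˡ {zero}  c f = sym≈ (zeroʳ c)
  ∑-*ˡ {suc n} c f = trans≈ (+-congˡ (∑-*ˡ c (λ k → f (F.suc k)))) (sym≈ (distribˡ c _ _))

  ∑-*ʳ : ∀ {n} c (f : Fin n → Carrier) → ∑ (λ k → f k * c) ≈ ∑ f * c
  ∑-*ʳ {zero}  c f = sym≈ (zeroˡ c)
  ∑-*ʳ {suc n} c f = trans≈ (+-congˡ (∑-*ʳ c (λ k → f (F.suc k)))) (sym≈ (distribʳ c _ _))

  ∑-zero : ∀ {n} (f : Fin n → Carrier) → (∀ k → f k ≈ 0#) → ∑ f ≈ 0#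
  ∑-zero {zero}  f h = refl≈
  ∑-zero {suc n} f h = trans≈ (+-cong (h F.zero) (∑-zero _ (λ k → h (F.suc k)))) (+-identityˡ 0#)

  ∑-swap : ∀ {m n} (f : Fin m → Fin n → Carrier) →
    ∑ (λ i → ∑ (λ j → f i j)) ≈ ∑ (λ j → ∑ (λ i → f i j))
  ∑-swap {zero}  {n} f = sym≈ (∑-zero {n} (λ j → ∑ (λ (i : Fin 0) → f i j)) (λ _ → refl≈))
  ∑-swap {suc m} f = begin
    ∑ (λ j → f F.zero j) + ∑ (λ i → ∑ (λ j → f (F.suc i) j))
      ≈⟨ +-congˡ (∑-swap (λ i j → f (F.suc i) j)) ⟩
    ∑ (λ j → f F.zero j) + ∑ (λ j → ∑ (λ i → f (F.suc i) j))
      ≈⟨ sym≈ (∑-+ (λ j → f F.zero j) (λ j → ∑ (λ i → f (F.suc i) j))) ⟩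
    ∑ (λ j → f F.zero j + ∑ (λ i → f (F.suc i) j)) ∎

  ∑-single : ∀ {n} (f : Fin n → Carrier) (i₀ : Fin n) → (∀ i → ¬ i ≡ i₀ → f i ≈ 0#) → ∑ f ≈ f i₀
  ∑-single {suc n} f F.zero vanish =
    trans≈ (+-congˡ (∑-zero _ (λ k → vanish (F.suc k) (λ ())))) (+-identityʳ _)
  ∑-single {suc n} f (F.suc i₀) vanish =
    trans≈ (+-cong (vanish F.zero (λ ()))
                   (∑-single (λ k → f (F.suc k)) i₀ (λ k k≢i₀ → vanish (F.suc k) (λ e → k≢i₀ (suc-injective e)))))
           (+-identityˡ _)

  ∑-split : ∀ m n (h : Fin m ⊎ Fin n → Carrier) →
    ∑ (λ k → h (splitAt m k)) ≈ ∑ (λ i → h (inj₁ i)) + ∑ (λ j → h (inj₂ j))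
  ∑-split zero    n h = sym≈ (+-identityˡ _)
  ∑-split (suc m) n h =
    trans≈ (+-congˡ (trans≈ (∑-cong splitAt-suc) (∑-split m n (λ x → h (Sum.map F.suc (λ z → z) x)))))
           (sym≈ (+-assoc _ _ _))
    where
    splitAt-suc : ∀ k → h (splitAt (suc m) (F.suc k)) ≈ h (Sum.map F.suc (λ z → z) (splitAt m k))
    splitAt-suc k with splitAt m k
    ... | inj₁ i = refl≈
    ... | inj₂ j = refl≈

  ∑-one : ∀ n → ∑ {n} (λ _ → 1#) ≈ ⟦ n ⟧
  ∑-one zero    = refl≈
  ∑-one (suc n) = +-congˡ (∑-one n)

  ^-+ : ∀ x a b → x ^ (a +ℕ b) ≈ (x ^ a) * (x ^ b)
  ^-+ x zero    b = sym≈ (*-identityˡ _)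
  ^-+ x (suc a) b = trans≈ (*-congˡ (^-+ x a b)) (sym≈ (*-assoc _ _ _))

  sumE : ∀ {A : Set} → Enum A → (A → Carrier) → Carrier
  sumE E w = ∑ (λ k → w (element E k))

  sumE-cong : ∀ {A : Set} (E : Enum A) {f g : A → Carrier} → (∀ a → f a ≈ g a) → sumE E f ≈ sumE E g
  sumE-cong E h = ∑-cong (λ k → h (element E k))

  sumE-*ˡ : ∀ {A : Set} (E : Enum A) c (f : A → Carrier) → sumE E (λ a → c * f a) ≈ c * sumE E f
  sumE-*ˡ E c f = ∑-*ˡ c (λ k → f (element E k))

  sumE-one : ∀ {A : Set} (E : Enum A) → sumE E (λ _ → 1#) ≈ ⟦ size E ⟧
  sumE-one E = ∑-one (size E)

  sumE-⊤ : (w : ⊤ → Carrier) → sumE ⊤-enum w ≈ w tt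
  sumE-⊤ w = +-identityʳ (w tt)

  sumE-⊕ : ∀ {A B : Set} (E₁ : Enum A) (E₂ : Enum B) (w : A ⊎ B → Carrier) →
    sumE (E₁ ⊕ E₂) w ≈ sumE E₁ (λ a → w (inj₁ a)) + sumE E₂ (λ b → w (inj₂ b))
  sumE-⊕ E₁ E₂ w = ∑-split (size E₁) (size E₂) (λ x → w (Sum.map (element E₁) (element E₂) x))

  sumE-Σ-Fin : ∀ m (Q : Fin m → Set) (E : ∀ k → Enum (Q k)) (w : Σ (Fin m) Q → Carrier) →
    sumE (Σ-Fin-enum m Q E) w ≈ ∑ (λ k → sumE (E k) (λ q → w (k , q)))
  sumE-Σ-Fin zero    Q E w = refl≈
  sumE-Σ-Fin (suc m) Q E w =
    trans≈ (sumE-⊕ (E F.zero) (Σ-Fin-enum m (λ k → Q (F.suc k)) (λ k → E (F.suc k))) (λ x → w (to (Σ-Fin-suc-↔ Q) x)))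
           (+-congˡ (sumE-Σ-Fin m (λ k → Q (F.suc k)) (λ k → E (F.suc k)) (λ { (k , q) → w (F.suc k , q) })))

  sumE-Σ : ∀ {A : Set} (EA : Enum A) (B : A → Set) (EB : ∀ a → Enum (B a)) (w : Σ A B → Carrier) →
    sumE (Σ-enum EA B EB) w ≈ sumE EA (λ a → sumE (EB a) (λ b → w (a , b)))
  sumE-Σ EA B EB w =
    sumE-Σ-Fin (size EA) (λ k → B (element EA k)) (λ k → EB (element EA k)) (λ { (k , b) → w (element EA k , b) })

-- (3) Coefficient extraction: the sizes of the fibres of two statistics
-- bounded by n are the coefficients of their generating polynomial.

Fibre : ∀ {A : Set} (a b : A → ℕ) (i j : ℕ) → A → Set
Fibre a b i j t = (a t ≡ i) × (b t ≡ j)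

fibre-irrelevant : ∀ {A : Set} (a b : A → ℕ) i j t → Irrelevant (Fibre a b i j t)
fibre-irrelevant a b i j t (p , q) (p′ , q′) = cong₂ _,_ (ℕP.≡-irrelevant p p′) (ℕP.≡-irrelevant q q′)

fibre? : ∀ {A : Set} (a b : A → ℕ) i j t → Dec (Fibre a b i j t)
fibre? a b i j t = (a t ≟ i) ×-dec (b t ≟ j)

fibre-enum : ∀ {A : Set} → Enum A → (a b : A → ℕ) (i j : ℕ) → Enum (Σ A (Fibre a b i j))
fibre-enum E a b i j =
  Σ-enum E (Fibre a b i j) (λ t → decidable-enum (fibre-irrelevant a b i j t) (fibre? a b i j t))

module Coefficients (R : CommutativeSemiring 0ℓ 0ℓ) where
  open CommutativeSemiring R renaming (refl to refl≈; sym to sym≈; trans to trans≈)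
  open SemiringOps R
  open Sums R
  open import Relation.Binary.Reasoning.Setoid setoid

  𝟙 : ∀ {P : Set} → Dec P → Carrier
  𝟙 (yes _) = 1#
  𝟙 (no _)  = 0#

  𝟙-yes : ∀ {P : Set} (d : Dec P) → P → 𝟙 d ≈ 1#
  𝟙-yes (yes _) _ = refl≈
  𝟙-yes (no ¬p) p = ⊥-elim (¬p p)

  𝟙-no : ∀ {P : Set} (d : Dec P) → ¬ P → 𝟙 d ≈ 0#
  𝟙-no (yes p) ¬p = ⊥-elim (¬p p)
  𝟙-no (no _)  _  = refl≈

  size-decidable-enum : ∀ {P : Set} (irr : Irrelevant P) (d : Dec P) → ⟦ size (decidable-enum irr d) ⟧ ≈ 𝟙 d
  size-decidable-enum irr (yes _) = +-identityʳ 1#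
  size-decidable-enum irr (no _)  = refl≈

  -- In the double sum over exponents i, j ≤ n only the term (p , q) survives.
  monomial-collapse : ∀ n p q → p ≤ n → q ≤ n → ∀ x y →
    ∑ (λ (i : Fin (suc n)) → ∑ (λ (j : Fin (suc n)) →
        𝟙 ((p ≟ toℕ i) ×-dec (q ≟ toℕ j)) * ((x ^ toℕ i) * (y ^ toℕ j))))
    ≈ (x ^ p) * (y ^ q)
  monomial-collapse n p q p≤n q≤n x y = begin
    ∑ (λ i → ∑ (λ j → term i j))   ≈⟨ ∑-single (λ i → ∑ (λ j → term i j)) i₀ row-vanishes ⟩
    ∑ (λ j → term i₀ j)            ≈⟨ ∑-single (term i₀) j₀ column-vanishes ⟩
    term i₀ j₀                     ≈⟨ *-congʳ (𝟙-yes ((p ≟ toℕ i₀) ×-dec (q ≟ toℕ j₀)) (sym i₀≡p , sym j₀≡q)) ⟩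
    1# * ((x ^ toℕ i₀) * (y ^ toℕ j₀)) ≈⟨ *-identityˡ _ ⟩
    (x ^ toℕ i₀) * (y ^ toℕ j₀)    ≈⟨ ≡⇒≈ (cong₂ (λ i j → (x ^ i) * (y ^ j)) i₀≡p j₀≡q) ⟩
    (x ^ p) * (y ^ q)              ∎
    where
    term : Fin (suc n) → Fin (suc n) → Carrier
    term i j = 𝟙 ((p ≟ toℕ i) ×-dec (q ≟ toℕ j)) * ((x ^ toℕ i) * (y ^ toℕ j))
    i₀ j₀ : Fin (suc n)
    i₀ = fromℕ< (s≤s p≤n)
    j₀ = fromℕ< (s≤s q≤n)
    i₀≡p : toℕ i₀ ≡ p
    i₀≡p = toℕ-fromℕ< (s≤s p≤n)
    j₀≡q : toℕ j₀ ≡ q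
    j₀≡q = toℕ-fromℕ< (s≤s q≤n)
    row-vanishes : ∀ i → ¬ i ≡ i₀ → ∑ (λ j → term i j) ≈ 0#
    row-vanishes i i≢i₀ = ∑-zero (term i) (λ j →
      trans≈ (*-congʳ (𝟙-no ((p ≟ toℕ i) ×-dec (q ≟ toℕ j))
                             (λ { (p≡i , _) → i≢i₀ (toℕ-injective (trans (sym p≡i) (sym i₀≡p))) })))
             (zeroˡ _))
    column-vanishes : ∀ j → ¬ j ≡ j₀ → term i₀ j ≈ 0#
    column-vanishes j j≢j₀ =
      trans≈ (*-congʳ (𝟙-no ((p ≟ toℕ i₀) ×-dec (q ≟ toℕ j))
                             (λ { (_ , q≡j) → j≢j₀ (toℕ-injective (trans (sym q≡j) (sym j₀≡q))) })))
             (zeroˡ _)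

  fibre-sizes-generate : ∀ {A : Set} (E : Enum A) n (a b : A → ℕ) →
    (∀ t → a t ≤ n) → (∀ t → b t ≤ n) → ∀ x y →
    ∑ (λ (i : Fin (suc n)) → ∑ (λ (j : Fin (suc n)) →
        ⟦ size (fibre-enum E a b (toℕ i) (toℕ j)) ⟧ * ((x ^ toℕ i) * (y ^ toℕ j))))
    ≈ sumE E (λ t → (x ^ a t) * (y ^ b t))
  fibre-sizes-generate {A} E n a b a≤n b≤n x y = begin
    ∑ (λ i → ∑ (λ j → ⟦ size (fibre-enum E a b (toℕ i) (toℕ j)) ⟧ * w i j))
      ≈⟨ ∑-cong (λ i → ∑-cong (λ j → trans≈ (*-congʳ (fibre-size (toℕ i) (toℕ j)))
                                            (sym≈ (∑-*ʳ (w i j) (λ k → δ (element E k) i j))))) ⟩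
    ∑ (λ i → ∑ (λ j → sumE E (λ t → δ t i j * w i j)))
      ≈⟨ ∑-cong (λ i → ∑-swap (λ j k → δ (element E k) i j * w i j)) ⟩
    ∑ (λ i → sumE E (λ t → ∑ (λ j → δ t i j * w i j)))
      ≈⟨ ∑-swap (λ i k → ∑ (λ j → δ (element E k) i j * w i j)) ⟩
    sumE E (λ t → ∑ (λ i → ∑ (λ j → δ t i j * w i j)))
      ≈⟨ sumE-cong E (λ t → monomial-collapse n (a t) (b t) (a≤n t) (b≤n t) x y) ⟩
    sumE E (λ t → (x ^ a t) * (y ^ b t)) ∎
    where
    w : Fin (suc n) → Fin (suc n) → Carrier
    w i j = (x ^ toℕ i) * (y ^ toℕ j)
    δ : A → Fin (suc n) → Fin (suc n) → Carrier
    δ t i j = 𝟙 (fibre? a b (toℕ i) (toℕ j) t)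
    fibre-size : ∀ i j → ⟦ size (fibre-enum E a b i j) ⟧ ≈ sumE E (λ t → 𝟙 (fibre? a b i j t))
    fibre-size i j = begin
      ⟦ size (fibre-enum E a b i j) ⟧           ≈⟨ sym≈ (sumE-one (fibre-enum E a b i j)) ⟩
      sumE (fibre-enum E a b i j) (λ _ → 1#)  ≈⟨ sumE-Σ E (Fibre a b i j) point-enum (λ _ → 1#) ⟩
      sumE E (λ t → sumE (point-enum t) (λ _ → 1#))
        ≈⟨ sumE-cong E (λ t → trans≈ (sumE-one (point-enum t)) (size-decidable-enum _ (fibre? a b i j t))) ⟩
      sumE E (λ t → 𝟙 (fibre? a b i j t)) ∎
      where
      point-enum : ∀ t → Enum (Fibre a b i j t)
      point-enum t = decidable-enum (fibre-irrelevant a b i j t) (fibre? a b i j t)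

record Valid {n} (s : Shape n) (F : Filling n) : Set where
  constructor mkValid
  field
    filled⇒cell      : ∀ k l → is-nothing (entry F k l) ≡ false → isCell s k l ≡ true
    left-clears-row  : ∀ k l l′ → isLeft (entry F k l) ≡ true → (toℕ l <ᵇ toℕ l′) ≡ true →
                       is-nothing (entry F k l′) ≡ true
    up-clears-column : ∀ k l k′ → isUp (entry F k l) ≡ true → (toℕ k′ <ᵇ toℕ k) ≡ true →
                       is-nothing (entry F k′ l) ≡ true
open Valid public

module _ {n} {s : Shape n} {F : Filling n} where
  private
    cellCond : Fin n → Fin n → Bool
    cellCond k l = not (is-nothing (entry F k l)) ⇒ᵇ isCell s k l
    leftCond : Fin n → Fin n → Bool
    leftCond k l = isLeft (entry F k l) ⇒ᵇ allFin (λ l′ → (toℕ l <ᵇ toℕ l′) ⇒ᵇ is-nothing (entry F k l′))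
    upCond : Fin n → Fin n → Bool
    upCond k l = isUp (entry F k l) ⇒ᵇ allFin (λ k′ → (toℕ k′ <ᵇ toℕ k) ⇒ᵇ is-nothing (entry F k′ l))

  valid→Valid : isAltTableau s F ≡ true → Valid s F
  valid→Valid ok = mkValid
    (λ k l h → ⇒ᵇ-elim {not (is-nothing (entry F k l))} (proj₁ (conds k l)) (not-intro h))
    (λ k l l′ h lt → ⇒ᵇ-elim {toℕ l <ᵇ toℕ l′}
       (allFin-elim (⇒ᵇ-elim {isLeft (entry F k l)} (proj₁ (proj₂ (conds k l))) h) l′) lt)
    (λ k l k′ h lt → ⇒ᵇ-elim {toℕ k′ <ᵇ toℕ k}
       (allFin-elim (⇒ᵇ-elim {isUp (entry F k l)} (proj₂ (proj₂ (conds k l))) h) k′) lt)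
    where
    conds : ∀ k l → (cellCond k l ≡ true) × ((leftCond k l ≡ true) × (upCond k l ≡ true))
    conds k l with ∧-elim {cellCond k l} (allFin-elim (allFin-elim ok k) l)
    ... | c , lu = c , ∧-elim {leftCond k l} lu

  Valid→valid : Valid s F → isAltTableau s F ≡ true
  Valid→valid v = allFin-intro λ k → allFin-intro λ l →
    ∧-intro {cellCond k l}
      (⇒ᵇ-intro {not (is-nothing (entry F k l))} (λ h → filled⇒cell v k l (not-elim h)))
      (∧-intro {leftCond k l}
        (⇒ᵇ-intro {isLeft (entry F k l)} (λ h →
          allFin-intro (λ l′ → ⇒ᵇ-intro {toℕ l <ᵇ toℕ l′} (left-clears-row v k l l′ h))))
        (⇒ᵇ-intro {isUp (entry F k l)} (λ h →
          allFin-intro (λ k′ → ⇒ᵇ-intro {toℕ k′ <ᵇ toℕ k} (up-clears-column v k l k′ h)))))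

tableau-≡ : ∀ {n} {s s′ : Shape n} {F F′ : Filling n} {v v′} → s ≡ s′ → F ≡ F′ → mkAT s F v ≡ mkAT s′ F′ v′
tableau-≡ {v = v} {v′} refl refl = cong (mkAT _ _) (bool-UIP v v′)

-- (5) Removing the first step of the border path

Row : ℕ → Set
Row n = Vec (Maybe Arrow) n

freeColumn : ∀ {n} → Shape n → Filling n → Fin n → Bool
freeColumn s F l = isCol s l ∧ not (anyFin (λ k → isUp (entry F k l)))

AllowedCells : ∀ {n} → (Fin n → Bool) → Row n → Set
AllowedCells c r = ∀ l → is-nothing (lookup r l) ≡ false → c l ≡ true

LeftClear : ∀ {n} → Row n → Set
LeftClear r = ∀ l l′ → isLeft (lookup r l) ≡ true → (toℕ l <ᵇ toℕ l′) ≡ true → is-nothing (lookup r l′) ≡ true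

-- Prepend a first step: a top row with content r and an empty first column.
prepend : ∀ {n} → Row n → Filling n → Filling (suc n)
prepend r F = (nothing ∷ r) ∷ map (nothing ∷_) F

prepend-row : ∀ {n} (F : Filling n) k → lookup (map (Maybe.nothing {A = Arrow} ∷_) F) k ≡ nothing ∷ lookup F k
prepend-row F k = lookup-map k _ F

-- Prepending a step b with an admissible top row preserves validity.  The
-- new row is above every old row, so it may only fill free columns.
prepend-Valid : ∀ {n} (b : Bool) (s : Shape n) (F : Filling n) (r : Row n) → Valid s F →
  AllowedCells (λ l → b ∧ freeColumn s F l) r → LeftClear r → Valid (b ∷ s) (prepend r F)
prepend-Valid {n} b s F r v allowed clear = mkValid cell-ok left-ok up-ok
  where
  G : Filling (suc n)
  G = prepend r F
  cell-ok : ∀ k l → is-nothing (entry G k l) ≡ false → isCell (b ∷ s) k l ≡ true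
  cell-ok F.zero F.zero ()
  cell-ok F.zero (F.suc l) h with ∧-elim {b} (allowed l h)
  ... | refl , free = cong (_∧ true) (proj₁ (∧-elim free))
  cell-ok (F.suc k) F.zero h rewrite prepend-row F k = ⊥-elim (true≢false h)
  cell-ok (F.suc k) (F.suc l) h rewrite prepend-row F k = filled⇒cell v k l h
  left-ok : ∀ k l l′ → isLeft (entry G k l) ≡ true → (toℕ l <ᵇ toℕ l′) ≡ true → is-nothing (entry G k l′) ≡ true
  left-ok F.zero F.zero l′ () _
  left-ok F.zero (F.suc l) F.zero _ ()
  left-ok F.zero (F.suc l) (F.suc l′) h lt = clear l l′ h lt
  left-ok (F.suc k) F.zero l′ h _ rewrite prepend-row F k = ⊥-elim (true≢false (sym h))
  left-ok (F.suc k) (F.suc l) F.zero _ ()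
  left-ok (F.suc k) (F.suc l) (F.suc l′) h lt rewrite prepend-row F k = left-clears-row v k l l′ h lt
  up-ok : ∀ k l k′ → isUp (entry G k l) ≡ true → (toℕ k′ <ᵇ toℕ k) ≡ true → is-nothing (entry G k′ l) ≡ true
  up-ok F.zero l k′ _ ()
  up-ok (F.suc k) F.zero k′ h _ rewrite prepend-row F k = ⊥-elim (true≢false (sym h))
  up-ok (F.suc k) (F.suc l) F.zero h _ rewrite prepend-row F k with lookup r l in eq
  ... | nothing = refl
  ... | just _ = ⊥-elim (true≢false (trans (sym (anyFin-witness k h))
                   (not-elim (proj₂ (∧-elim (proj₂ (∧-elim {b} (allowed l (cong is-nothing eq)))))))))
  up-ok (F.suc k) (F.suc l) (F.suc k′) h lt rewrite prepend-row F k | prepend-row F k′ = up-clears-column v k l k′ h lt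

-- Conversely, a valid filling of length 1+n is a prepended one: its first
-- column is empty, it restricts to a valid filling of length n, and its
-- top row is admissible.
module Peel {n} (b : Bool) (s : Shape n) (e₀ : Maybe Arrow) (r₀ : Row n)
             (rows : Vec (Vec (Maybe Arrow) (suc n)) n) (v : Valid (b ∷ s) ((e₀ ∷ r₀) ∷ rows)) where

  rest : Filling n
  rest = map tail rows

  entry-rest : ∀ k l → entry rest k l ≡ entry ((e₀ ∷ r₀) ∷ rows) (F.suc k) (F.suc l)
  entry-rest k l = trans (cong (λ z → lookup z l) (lookup-map k tail rows)) (lookup-tail (lookup rows k) l)
    where
    lookup-tail : ∀ {A : Set} {m} (u : Vec A (suc m)) l → lookup (tail u) l ≡ lookup u (F.suc l)
    lookup-tail (_ ∷ _) l = refl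

  -- The cell (0,0) is never part of the diagram.
  corner-empty : e₀ ≡ nothing
  corner-empty = empty b e₀ (filled⇒cell v F.zero F.zero)
    where
    empty : ∀ b e → (is-nothing e ≡ false → (b ∧ (not b ∧ false)) ≡ true) → e ≡ nothing
    empty b     nothing  _ = refl
    empty true  (just _) h with h refl
    ... | ()
    empty false (just _) h with h refl
    ... | ()

  -- Column 0 has no cells.
  first-column-empty : ∀ k → lookup (lookup rows k) F.zero ≡ nothing
  first-column-empty k with lookup (lookup rows k) F.zero in eq
  ... | nothing = refl
  ... | just _ = ⊥-elim (no-cell (lookup s k) (not b) (filled⇒cell v (F.suc k) F.zero (cong is-nothing eq)))
    where
    no-cell : ∀ x y → x ∧ (y ∧ false) ≡ true → ⊥
    no-cell true true ()

  -- If the first step is a column, row 0 has no cells.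
  top-row-empty : b ≡ false → ∀ l → lookup r₀ l ≡ nothing
  top-row-empty refl l with lookup r₀ l in eq
  ... | nothing = refl
  ... | just _ with filled⇒cell v F.zero (F.suc l) (cong is-nothing eq)
  ... | ()

  rest-Valid : Valid s rest
  rest-Valid = mkValid
    (λ k l h → filled⇒cell v (F.suc k) (F.suc l) (trans (cong is-nothing (sym (entry-rest k l))) h))
    (λ k l l′ h lt → trans (cong is-nothing (entry-rest k l′))
       (left-clears-row v (F.suc k) (F.suc l) (F.suc l′) (trans (cong isLeft (sym (entry-rest k l))) h) lt))
    (λ k l k′ h lt → trans (cong is-nothing (entry-rest k′ l))
       (up-clears-column v (F.suc k) (F.suc l) (F.suc k′) (trans (cong isUp (sym (entry-rest k l))) h) lt))

  -- A filled cell of row 0 lies in a free column of the rest: an up arrow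
  -- below it would require it to be empty.
  top-row-allowed : AllowedCells (λ l → b ∧ freeColumn s rest l) r₀
  top-row-allowed l filled = free b (filled⇒cell v F.zero (F.suc l) filled)
    where
    no-up : ∀ k → isUp (entry rest k l) ≡ false
    no-up k with isUp (entry rest k l) in eq
    ... | false = refl
    ... | true = ⊥-elim (true≢false (trans (sym (up-clears-column v (F.suc k) (F.suc l) F.zero
                   (trans (cong isUp (sym (entry-rest k l))) eq) refl)) filled))
    free : ∀ b′ → (b′ ∧ (isCol s l ∧ true)) ≡ true → (b′ ∧ freeColumn s rest l) ≡ true
    free true q rewrite anyFin-none no-up with isCol s l
    ... | true = refl
    free false ()

  top-row-clear : LeftClear r₀
  top-row-clear l l′ h lt = left-clears-row v F.zero (F.suc l) (F.suc l′) h lt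

-- Admissible top rows, checked by a recursion along the row: a left arrow
-- must be the last filled cell, and filled cells need allowed columns.
allEmpty : ∀ {n} → Row n → Bool
allEmpty []            = true
allEmpty (nothing ∷ r) = allEmpty r
allEmpty (just _ ∷ r)  = false

topRowOK : ∀ {n} → (Fin n → Bool) → Row n → Bool
topRowOK c []              = true
topRowOK c (nothing ∷ r)   = topRowOK (λ l → c (F.suc l)) r
topRowOK c (just up ∷ r)   = c F.zero ∧ topRowOK (λ l → c (F.suc l)) r
topRowOK c (just left ∷ r) = c F.zero ∧ allEmpty r

allEmpty-lookup : ∀ {n} (r : Row n) → allEmpty r ≡ true → ∀ l → lookup r l ≡ nothing
allEmpty-lookup (nothing ∷ r) h F.zero    = refl
allEmpty-lookup (nothing ∷ r) h (F.suc l) = allEmpty-lookup r h l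

lookup-allEmpty : ∀ {n} (r : Row n) → (∀ l → lookup r l ≡ nothing) → allEmpty r ≡ true
lookup-allEmpty []      h = refl
lookup-allEmpty (x ∷ r) h with h F.zero
... | refl = lookup-allEmpty r (λ l → h (F.suc l))

allEmpty-replicate : ∀ n → allEmpty (replicate n (Maybe.nothing {A = Arrow})) ≡ true
allEmpty-replicate zero    = refl
allEmpty-replicate (suc n) = allEmpty-replicate n

replicate-empty : ∀ {n} (r : Row n) → (∀ l → lookup r l ≡ nothing) → replicate n nothing ≡ r
replicate-empty []      h = refl
replicate-empty (x ∷ r) h = cong₂ _∷_ (sym (h F.zero)) (replicate-empty r (λ l → h (F.suc l)))

topRowOK⇒allowed : ∀ {n} (c : Fin n → Bool) (r : Row n) → topRowOK c r ≡ true → AllowedCells c r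
topRowOK⇒allowed c (nothing ∷ r) ok F.zero ()
topRowOK⇒allowed c (nothing ∷ r) ok (F.suc l) h = topRowOK⇒allowed (λ l → c (F.suc l)) r ok l h
topRowOK⇒allowed c (just up ∷ r) ok F.zero h = proj₁ (∧-elim {c F.zero} ok)
topRowOK⇒allowed c (just up ∷ r) ok (F.suc l) h =
  topRowOK⇒allowed (λ l → c (F.suc l)) r (proj₂ (∧-elim {c F.zero} ok)) l h
topRowOK⇒allowed c (just left ∷ r) ok F.zero h = proj₁ (∧-elim {c F.zero} ok)
topRowOK⇒allowed c (just left ∷ r) ok (F.suc l) h
  rewrite allEmpty-lookup r (proj₂ (∧-elim {c F.zero} ok)) l = ⊥-elim (true≢false h)

topRowOK⇒clear : ∀ {n} (c : Fin n → Bool) (r : Row n) → topRowOK c r ≡ true → LeftClear r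
topRowOK⇒clear c (nothing ∷ r) ok F.zero l′ ()
topRowOK⇒clear c (nothing ∷ r) ok (F.suc l) F.zero h ()
topRowOK⇒clear c (nothing ∷ r) ok (F.suc l) (F.suc l′) h lt = topRowOK⇒clear (λ l → c (F.suc l)) r ok l l′ h lt
topRowOK⇒clear c (just up ∷ r) ok F.zero l′ ()
topRowOK⇒clear c (just up ∷ r) ok (F.suc l) F.zero h ()
topRowOK⇒clear c (just up ∷ r) ok (F.suc l) (F.suc l′) h lt =
  topRowOK⇒clear (λ l → c (F.suc l)) r (proj₂ (∧-elim {c F.zero} ok)) l l′ h lt
topRowOK⇒clear c (just left ∷ r) ok F.zero F.zero h ()
topRowOK⇒clear c (just left ∷ r) ok F.zero (F.suc l′) h lt
  rewrite allEmpty-lookup r (proj₂ (∧-elim {c F.zero} ok)) l′ = refl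
topRowOK⇒clear c (just left ∷ r) ok (F.suc l) l′ h lt
  rewrite allEmpty-lookup r (proj₂ (∧-elim {c F.zero} ok)) l = ⊥-elim (true≢false (sym h))

topRowOK-intro : ∀ {n} (c : Fin n → Bool) (r : Row n) → AllowedCells c r → LeftClear r → topRowOK c r ≡ true
topRowOK-intro c [] _ _ = refl
topRowOK-intro c (nothing ∷ r) allowed clear =
  topRowOK-intro (λ l → c (F.suc l)) r (λ l → allowed (F.suc l)) (λ l l′ → clear (F.suc l) (F.suc l′))
topRowOK-intro c (just up ∷ r) allowed clear =
  ∧-intro (allowed F.zero refl)
    (topRowOK-intro (λ l → c (F.suc l)) r (λ l → allowed (F.suc l)) (λ l l′ → clear (F.suc l) (F.suc l′)))
topRowOK-intro c (just left ∷ r) allowed clear = ∧-intro (allowed F.zero refl) (lookup-allEmpty r rest-empty)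
  where
  rest-empty : ∀ l → lookup r l ≡ nothing
  rest-empty l with lookup r l in eq | clear F.zero (F.suc l) refl refl
  ... | nothing | _ = refl

TopRow : ∀ {n} → (Fin n → Bool) → Set
TopRow {n} c = Σ (Row n) (λ r → topRowOK c r ≡ true)

-- The ways to prepend a step to T: a new column, or a new top row over the
-- free columns of T.
Extension : ∀ {n} → AltTableau n → Set
Extension T = ⊤ ⊎ TopRow (freeColumn (shape T) (filling T))

attach : ∀ {n} → Σ (AltTableau n) Extension → AltTableau (suc n)
attach {n} (mkAT s F ok , inj₁ tt) =
  mkAT (false ∷ s) (prepend (replicate n nothing) F)
    (Valid→valid (prepend-Valid false s F (replicate n nothing) (valid→Valid ok) allowed clear))
  where
  allowed : AllowedCells (λ l → false ∧ freeColumn s F l) (replicate n nothing)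
  allowed l h = ⊥-elim (true≢false (trans (sym (cong is-nothing (lookup-replicate l nothing))) h))
  clear : LeftClear (replicate n nothing)
  clear l l′ h _ = ⊥-elim (true≢false (trans (sym h) (cong isLeft (lookup-replicate l nothing))))
attach (mkAT s F ok , inj₂ (r , r-ok)) =
  mkAT (true ∷ s) (prepend r F)
    (Valid→valid (prepend-Valid true s F r (valid→Valid ok) (topRowOK⇒allowed _ r r-ok) (topRowOK⇒clear _ r r-ok)))

detach : ∀ {n} → AltTableau (suc n) → Σ (AltTableau n) Extension
detach (mkAT (false ∷ s) ((e₀ ∷ r₀) ∷ rows) ok) =
  mkAT s (Peel.rest false s e₀ r₀ rows v) (Valid→valid (Peel.rest-Valid false s e₀ r₀ rows v)) , inj₁ tt
  where v = valid→Valid ok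
detach (mkAT (true ∷ s) ((e₀ ∷ r₀) ∷ rows) ok) =
  mkAT s (Peel.rest true s e₀ r₀ rows v) (Valid→valid (Peel.rest-Valid true s e₀ r₀ rows v))
  , inj₂ (r₀ , topRowOK-intro _ r₀ (Peel.top-row-allowed true s e₀ r₀ rows v) (Peel.top-row-clear true s e₀ r₀ rows v))
  where v = valid→Valid ok

unprepend : ∀ {n m} (rows : Vec (Vec (Maybe Arrow) (suc n)) m) → (∀ k → lookup (lookup rows k) F.zero ≡ nothing) →
  map (nothing ∷_) (map tail rows) ≡ rows
unprepend []                 h = refl
unprepend ((x ∷ row) ∷ rows) h = cong₂ _∷_ (cong (_∷ row) (sym (h F.zero))) (unprepend rows (λ k → h (F.suc k)))

tail-prepend : ∀ {n m} (F : Vec (Vec (Maybe Arrow) n) m) → map tail (map (nothing ∷_) F) ≡ F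
tail-prepend []      = refl
tail-prepend (x ∷ F) = cong (x ∷_) (tail-prepend F)

attach-detach : ∀ {n} (T : AltTableau (suc n)) → attach (detach T) ≡ T
attach-detach (mkAT (false ∷ s) ((e₀ ∷ r₀) ∷ rows) ok) =
  tableau-≡ refl (cong₂ _∷_ (cong₂ _∷_ (sym (Peel.corner-empty false s e₀ r₀ rows v))
                                       (replicate-empty r₀ (Peel.top-row-empty false s e₀ r₀ rows v refl)))
                            (unprepend rows (Peel.first-column-empty false s e₀ r₀ rows v)))
  where v = valid→Valid ok
attach-detach (mkAT (true ∷ s) ((e₀ ∷ r₀) ∷ rows) ok) =
  tableau-≡ refl (cong₂ _∷_ (cong (_∷ r₀) (sym (Peel.corner-empty true s e₀ r₀ rows v)))
                            (unprepend rows (Peel.first-column-empty true s e₀ r₀ rows v)))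
  where v = valid→Valid ok

detach-attach : ∀ {n} (x : Σ (AltTableau n) Extension) → detach (attach x) ≡ x
detach-attach (mkAT s F ok , inj₁ tt) = column-case (tail-prepend F)
  where
  column-case : ∀ {F′} (eq : F′ ≡ F) {ok′} →
    _≡_ {A = Σ (AltTableau _) Extension} (mkAT s F′ ok′ , inj₁ tt) (mkAT s F ok , inj₁ tt)
  column-case refl {ok′} rewrite bool-UIP ok′ ok = refl
detach-attach (mkAT s F ok , inj₂ (r , r-ok)) = row-case (tail-prepend F)
  where
  row-case : ∀ {F′} (eq : F′ ≡ F) {ok′ r-ok′} →
    _≡_ {A = Σ (AltTableau _) Extension} (mkAT s F′ ok′ , inj₂ (r , r-ok′)) (mkAT s F ok , inj₂ (r , r-ok))
  row-case refl {ok′} {r-ok′} rewrite bool-UIP ok′ ok | bool-UIP r-ok′ r-ok = refl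

first-step-↔ : ∀ {n} → Σ (AltTableau n) Extension ↔ AltTableau (suc n)
first-step-↔ = mk↔ₛ′ attach detach attach-detach detach-attach

-- (6) The statistics across the first-step bijection

rowIsFree : ∀ {n} → Row n → Bool
rowIsFree r = not (anyFin (λ l → isLeft (lookup r l)))

stillFree : ∀ {n} → (Fin n → Bool) → Row n → ℕ
stillFree c r = countFin (λ l → c l ∧ not (isUp (lookup r l)))

freeRows-prepend : ∀ {n} b (s : Shape n) F (r : Row n) →
  freeRows (b ∷ s) (prepend r F) ≡ bit (b ∧ rowIsFree r) +ℕ freeRows s F
freeRows-prepend b s F r =
  cong (_ +ℕ_) (countFin-cong (λ k → cong (λ z → lookup s k ∧ rowIsFree z) (prepend-row F k)))

freeCols-prepend : ∀ {n} b (s : Shape n) F (r : Row n) → freeCols (b ∷ s) (prepend r F) ≡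
  bit (not b) +ℕ countFin (λ l → isCol s l ∧ not (isUp (lookup r l) ∨ anyFin (λ k → isUp (entry F k l))))
freeCols-prepend b s F r = cong₂ _+ℕ_ (first-column b)
  (countFin-cong λ l → cong (λ z → isCol s l ∧ not (isUp (lookup r l) ∨ z))
    (anyFin-cong (λ k → cong (λ z → isUp (lookup z (F.suc l))) (prepend-row F k))))
  where
  no-up : anyFin (λ k → isUp (entry (prepend r F) (F.suc k) F.zero)) ≡ false
  no-up = anyFin-none (λ k → cong (λ z → isUp (lookup z F.zero)) (prepend-row F k))
  first-column : ∀ b → bit (not b ∧ not (anyFin (λ k → isUp (entry (prepend r F) (F.suc k) F.zero)))) ≡ bit (not b)
  first-column true  = refl
  first-column false rewrite no-up = refl

freeCols-new-row : ∀ {n} (s : Shape n) F (r : Row n) → freeCols (true ∷ s) (prepend r F) ≡ stillFree (freeColumn s F) r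
freeCols-new-row s F r =
  trans (freeCols-prepend true s F r) (countFin-cong (λ l → reassociate (isCol s l) (isUp (lookup r l)) _))
  where
  reassociate : ∀ a u v → (a ∧ not (u ∨ v)) ≡ ((a ∧ not v) ∧ not u)
  reassociate false u     v = refl
  reassociate true  true  v = sym (BoolP.∧-zeroʳ (not v))
  reassociate true  false v = sym (BoolP.∧-identityʳ (not v))

freeCols-new-column : ∀ {n} (s : Shape n) F → freeCols (false ∷ s) (prepend (replicate n nothing) F) ≡ suc (freeCols s F)
freeCols-new-column {n} s F = trans (freeCols-prepend false s F (replicate n nothing))
  (cong suc (countFin-cong (λ l →
    cong (λ z → isCol s l ∧ not (isUp z ∨ anyFin (λ k → isUp (entry F k l)))) (lookup-replicate l nothing))))

stillFree-empty : ∀ {n} (c : Fin n → Bool) → stillFree c (replicate n nothing) ≡ countFin c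
stillFree-empty {zero}  c = refl
stillFree-empty {suc n} c =
  cong₂ _+ℕ_ (cong bit (BoolP.∧-identityʳ (c F.zero))) (stillFree-empty (λ l → c (F.suc l)))

topRow-≡ : ∀ {n} {c : Fin n → Bool} {r r′ : Row n} → r ≡ r′ → {p : topRowOK c r ≡ true} {p′ : topRowOK c r′ ≡ true} →
  _≡_ {A = TopRow c} (r , p) (r′ , p′)
topRow-≡ refl {p} {p′} = cong (_ ,_) (bool-UIP p p′)

topRow-forbidden-↔ : ∀ {n} (c : Fin (suc n) → Bool) → c F.zero ≡ false →
  TopRow (λ l → c (F.suc l)) ↔ TopRow c
topRow-forbidden-↔ {n} c forbidden = mk↔ₛ′ extend restrict extend-restrict (λ _ → refl)
  where
  impossible : ∀ {a r} → topRowOK c (just a ∷ r) ≡ true → ⊥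
  impossible {a = up}   ok = true≢false (trans (sym (proj₁ (∧-elim {c F.zero} ok))) forbidden)
  impossible {a = left} ok = true≢false (trans (sym (proj₁ (∧-elim {c F.zero} ok))) forbidden)
  extend : TopRow (λ l → c (F.suc l)) → TopRow c
  extend (r , ok) = nothing ∷ r , ok
  restrict : TopRow c → TopRow (λ l → c (F.suc l))
  restrict (nothing ∷ r , ok) = r , ok
  restrict (just a ∷ r , ok)  = ⊥-elim (impossible {a = a} ok)
  extend-restrict : ∀ x → extend (restrict x) ≡ x
  extend-restrict (nothing ∷ r , ok) = refl
  extend-restrict (just a ∷ r , ok)  = ⊥-elim (impossible {a = a} ok)

-- If the first column is allowed, its cell is empty, an up arrow (the rest
-- is arbitrary), or a left arrow (the rest is empty).
topRow-allowed-↔ : ∀ {n} (c : Fin (suc n) → Bool) → c F.zero ≡ true →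
  (TopRow (λ l → c (F.suc l)) ⊎ (TopRow (λ l → c (F.suc l)) ⊎ ⊤)) ↔ TopRow c
topRow-allowed-↔ {n} c allowed = mk↔ₛ′ build cases build-cases cases-build
  where
  c′ : Fin n → Bool
  c′ l = c (F.suc l)
  build : TopRow c′ ⊎ (TopRow c′ ⊎ ⊤) → TopRow c
  build (inj₁ (r , ok))        = nothing ∷ r , ok
  build (inj₂ (inj₁ (r , ok))) = just up ∷ r , trans (cong (_∧ topRowOK c′ r) allowed) ok
  build (inj₂ (inj₂ tt))       =
    just left ∷ replicate n nothing , trans (cong (_∧ allEmpty (replicate n nothing)) allowed) (allEmpty-replicate n)
  cases : TopRow c → TopRow c′ ⊎ (TopRow c′ ⊎ ⊤)
  cases (nothing ∷ r , ok)   = inj₁ (r , ok)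
  cases (just up ∷ r , ok)   = inj₂ (inj₁ (r , proj₂ (∧-elim {c F.zero} ok)))
  cases (just left ∷ r , ok) = inj₂ (inj₂ tt)
  build-cases : ∀ x → build (cases x) ≡ x
  build-cases (nothing ∷ r , ok)   = refl
  build-cases (just up ∷ r , ok)   = topRow-≡ refl
  build-cases (just left ∷ r , ok) =
    topRow-≡ (cong (just left ∷_) (replicate-empty r (allEmpty-lookup r (proj₂ (∧-elim {c F.zero} ok)))))
  cases-build : ∀ x → cases (build x) ≡ x
  cases-build (inj₁ (r , ok))        = refl
  cases-build (inj₂ (inj₁ (r , ok))) = cong (λ z → inj₂ (inj₁ z)) (topRow-≡ refl)
  cases-build (inj₂ (inj₂ tt))       = refl

topRow-empty-↔ : (c : Fin 0 → Bool) → ⊤ ↔ TopRow c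
topRow-empty-↔ c = mk↔ₛ′ (λ _ → [] , refl) (λ _ → tt) (λ { ([] , _) → topRow-≡ refl }) (λ _ → refl)

mutual
  topRow-enum : ∀ {n} (c : Fin n → Bool) → Enum (TopRow c)
  topRow-enum {zero}  c = ⊤-enum ▷ topRow-empty-↔ c
  topRow-enum {suc n} c = topRow-enum-by c (c F.zero) refl

  topRow-enum-by : ∀ {n} (c : Fin (suc n) → Bool) b → c F.zero ≡ b → Enum (TopRow c)
  topRow-enum-by c false eq = topRow-enum (λ l → c (F.suc l)) ▷ topRow-forbidden-↔ c eq
  topRow-enum-by c true  eq =
    (topRow-enum (λ l → c (F.suc l)) ⊕ (topRow-enum (λ l → c (F.suc l)) ⊕ ⊤-enum)) ▷ topRow-allowed-↔ c eq

extension-enum : ∀ {n} (T : AltTableau n) → Enum (Extension T)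
extension-enum T = ⊤-enum ⊕ topRow-enum (freeColumn (shape T) (filling T))

tableau-empty-↔ : ⊤ ↔ AltTableau 0
tableau-empty-↔ =
  mk↔ₛ′ (λ _ → mkAT [] [] refl) (λ _ → tt) (λ { (mkAT [] [] _) → tableau-≡ refl refl }) (λ _ → refl)

tableau-enum : ∀ n → Enum (AltTableau n)
tableau-enum zero    = ⊤-enum ▷ tableau-empty-↔
tableau-enum (suc n) = Σ-enum (tableau-enum n) Extension extension-enum ▷ first-step-↔

-- (8) The weighted sum  A_n(x,y) = ∑_T x^(free rows) y^(free columns)

freeRowsOf freeColsOf : ∀ {n} → AltTableau n → ℕ
freeRowsOf T = freeRows (shape T) (filling T)
freeColsOf T = freeCols (shape T) (filling T)

module GeneratingFunction (R : CommutativeSemiring 0ℓ 0ℓ) where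
  open CommutativeSemiring R renaming (refl to refl≈; sym to sym≈; trans to trans≈)
  open SemiringOps R
  open Sums R
  open Coefficients R using (fibre-sizes-generate)
  open import Relation.Binary.Reasoning.Setoid setoid
  open import Algebra.Solver.Ring.NaturalCoefficients.Default R using (solve; _:+_; _:*_; _:=_)

  weight : Carrier → Carrier → ∀ {n} → AltTableau n → Carrier
  weight x y T = (x ^ freeRowsOf T) * (y ^ freeColsOf T)

  A : ℕ → Carrier → Carrier → Carrier
  A n x y = sumE (tableau-enum n) (weight x y)

  module TopRowSum (x y : Carrier) where

    -- The part of the weight contributed by a new top row.
    rowWeight : ∀ {n} (c : Fin n → Bool) → TopRow c → Carrier
    rowWeight c (r , _) = (x ^ bit (rowIsFree r)) * (y ^ stillFree c r)

    -- With an allowed first column the three cases contribute y S, S and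
    -- y^(1+m), where S is the sum over the remaining columns.
    allowed-first-column : ∀ {n} (c : Fin (suc n) → Bool) (allowed : c F.zero ≡ true) →
      let c′ = λ l → c (F.suc l)
          S  = sumE (topRow-enum c′) (rowWeight c′)
      in sumE (topRow-enum-by c true allowed) (rowWeight c) ≈ y * S + (S + y * (y ^ countFin c′))
    allowed-first-column {n} c allowed = begin
      sumE (E ⊕ (E ⊕ ⊤-enum)) w
        ≈⟨ sumE-⊕ E (E ⊕ ⊤-enum) w ⟩
      sumE E (λ t → w (inj₁ t)) + sumE (E ⊕ ⊤-enum) (λ t → w (inj₂ t))
        ≈⟨ +-congˡ (sumE-⊕ E ⊤-enum (λ t → w (inj₂ t))) ⟩
      sumE E (λ t → w (inj₁ t)) + (sumE E (λ t → w (inj₂ (inj₁ t))) + sumE ⊤-enum (λ t → w (inj₂ (inj₂ t))))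
        ≈⟨ +-cong (trans≈ (sumE-cong E empty-cell) (sumE-*ˡ E y (rowWeight c′)))
                  (+-cong (sumE-cong E up-arrow) (trans≈ (sumE-⊤ (λ t → w (inj₂ (inj₂ t)))) left-arrow)) ⟩
      y * sumE E (rowWeight c′) + (sumE E (rowWeight c′) + y * (y ^ countFin c′)) ∎
      where
      c′ : Fin n → Bool
      c′ l = c (F.suc l)
      E : Enum (TopRow c′)
      E = topRow-enum c′
      w : TopRow c′ ⊎ (TopRow c′ ⊎ ⊤) → Carrier
      w t = rowWeight c (to (topRow-allowed-↔ c allowed) t)
      empty-cell : ∀ t → w (inj₁ t) ≈ y * rowWeight c′ t
      empty-cell (r , _) = trans≈
        (≡⇒≈ (cong (λ b → (x ^ bit (rowIsFree r)) * (y ^ (bit (b ∧ true) +ℕ stillFree c′ r))) allowed))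
        (solve 3 (λ p q z → p :* (z :* q) := z :* (p :* q)) refl≈ _ _ y)
      up-arrow : ∀ t → w (inj₂ (inj₁ t)) ≈ rowWeight c′ t
      up-arrow (r , _) = ≡⇒≈ (cong (λ b → (x ^ bit (rowIsFree r)) * (y ^ (bit (b ∧ false) +ℕ stillFree c′ r))) allowed)
      left-arrow : w (inj₂ (inj₂ tt)) ≈ y * (y ^ countFin c′)
      left-arrow = trans≈
        (≡⇒≈ (cong₂ (λ b k → (x ^ 0) * (y ^ (bit (b ∧ true) +ℕ k))) allowed (stillFree-empty c′)))
        (*-identityˡ _)

    -- Over the m = countFin c allowed columns, new top rows together with
    -- the new column (weight y^(1+m)) sum to (x+y)(1+y)^m.
    mutual
      topRow-sum : ∀ {n} (c : Fin n → Bool) →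
        y * (y ^ countFin c) + sumE (topRow-enum c) (rowWeight c) ≈ (x + y) * ((1# + y) ^ countFin c)
      topRow-sum {zero} c = begin
        y * 1# + ((x * 1#) * 1# + 0#)
          ≈⟨ +-cong (*-identityʳ y) (trans≈ (+-identityʳ _) (trans≈ (*-identityʳ _) (*-identityʳ x))) ⟩
        y + x                          ≈⟨ +-comm y x ⟩
        x + y                          ≈⟨ sym≈ (*-identityʳ _) ⟩
        (x + y) * 1#                   ∎
      topRow-sum {suc n} c = topRow-sum-by c (c F.zero) refl

      topRow-sum-by : ∀ {n} (c : Fin (suc n) → Bool) b (eq : c F.zero ≡ b) →
        y * (y ^ countFin c) + sumE (topRow-enum-by c b eq) (rowWeight c) ≈ (x + y) * ((1# + y) ^ countFin c)
      topRow-sum-by {n} c false forbidden = begin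
        y * (y ^ countFin c) + sumE (topRow-enum c′) (λ t → rowWeight c (to (topRow-forbidden-↔ c forbidden) t))
          ≈⟨ +-cong (≡⇒≈ (cong (λ k → y * (y ^ k)) same-count)) (sumE-cong (topRow-enum c′) same-weight) ⟩
        y * (y ^ countFin c′) + sumE (topRow-enum c′) (rowWeight c′)
          ≈⟨ topRow-sum c′ ⟩
        (x + y) * ((1# + y) ^ countFin c′)
          ≈⟨ ≡⇒≈ (cong (λ k → (x + y) * ((1# + y) ^ k)) (sym same-count)) ⟩
        (x + y) * ((1# + y) ^ countFin c) ∎
        where
        c′ : Fin n → Bool
        c′ l = c (F.suc l)
        same-count : countFin c ≡ countFin c′
        same-count = cong (λ b → bit b +ℕ countFin c′) forbidden
        same-weight : ∀ t → rowWeight c (to (topRow-forbidden-↔ c forbidden) t) ≈ rowWeight c′ t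
        same-weight (r , _) =
          ≡⇒≈ (cong (λ b → (x ^ bit (rowIsFree r)) * (y ^ (bit (b ∧ true) +ℕ stillFree c′ r))) forbidden)
      topRow-sum-by {n} c true allowed = begin
        y * (y ^ countFin c) + sumE (topRow-enum-by c true allowed) (rowWeight c)
          ≈⟨ +-cong (≡⇒≈ (cong (λ k → y * (y ^ k)) one-more)) (allowed-first-column c allowed) ⟩
        y * (y * a) + (y * S + (S + y * a))
          ≈⟨ solve 3 (λ y a S → y :* (y :* a) :+ (y :* S :+ (S :+ y :* a)) := (y :* a :+ S) :+ y :* (y :* a :+ S))
                     refl≈ y a S ⟩
        (y * a + S) + y * (y * a + S)
          ≈⟨ trans≈ (+-congʳ (sym≈ (*-identityˡ _))) (sym≈ (distribʳ _ _ _)) ⟩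
        (1# + y) * (y * a + S)
          ≈⟨ *-congˡ (topRow-sum c′) ⟩
        (1# + y) * ((x + y) * P)
          ≈⟨ solve 3 (λ o z P → o :* (z :* P) := z :* (o :* P)) refl≈ (1# + y) (x + y) P ⟩
        (x + y) * ((1# + y) ^ suc (countFin c′))
          ≈⟨ ≡⇒≈ (cong (λ k → (x + y) * ((1# + y) ^ k)) (sym one-more)) ⟩
        (x + y) * ((1# + y) ^ countFin c) ∎
        where
        c′ : Fin n → Bool
        c′ l = c (F.suc l)
        a P S : Carrier
        a = y ^ countFin c′
        P = (1# + y) ^ countFin c′
        S = sumE (topRow-enum c′) (rowWeight c′)
        one-more : countFin c ≡ suc (countFin c′)
        one-more = cong (λ b → bit b +ℕ countFin c′) allowed

  open TopRowSum using (rowWeight; topRow-sum)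

  extension-sum : ∀ x y {n} (T : AltTableau n) →
    sumE (extension-enum T) (λ e → weight x y (attach (T , e)))
    ≈ (x ^ freeRows (shape T) (filling T)) * ((x + y) * ((1# + y) ^ freeCols (shape T) (filling T)))
  extension-sum x y {n} (mkAT s F ok) = begin
    sumE (⊤-enum ⊕ topRow-enum c) w
      ≈⟨ sumE-⊕ ⊤-enum (topRow-enum c) w ⟩
    sumE ⊤-enum (λ u → w (inj₁ u)) + sumE (topRow-enum c) (λ t → w (inj₂ t))
      ≈⟨ +-cong (trans≈ (sumE-⊤ (λ u → w (inj₁ u))) new-column)
                (trans≈ (sumE-cong (topRow-enum c) new-row) (sumE-*ˡ (topRow-enum c) X (rowWeight x y c))) ⟩
    X * (y * (y ^ countFin c)) + X * sumE (topRow-enum c) (rowWeight x y c)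
      ≈⟨ sym≈ (distribˡ _ _ _) ⟩
    X * (y * (y ^ countFin c) + sumE (topRow-enum c) (rowWeight x y c))
      ≈⟨ *-congˡ (topRow-sum x y c) ⟩
    X * ((x + y) * ((1# + y) ^ countFin c)) ∎
    where
    c : Fin n → Bool
    c = freeColumn s F
    X : Carrier
    X = x ^ freeRows s F
    w : Extension (mkAT s F ok) → Carrier
    w e = weight x y (attach (mkAT s F ok , e))
    new-column : w (inj₁ tt) ≈ X * (y * (y ^ countFin c))
    new-column = ≡⇒≈ (cong₂ (λ a b → (x ^ a) * (y ^ b))
                   (freeRows-prepend false s F (replicate n nothing)) (freeCols-new-column s F))
    new-row : ∀ t → w (inj₂ t) ≈ X * rowWeight x y c t
    new-row (r , _) = trans≈
      (≡⇒≈ (cong₂ (λ a b → (x ^ a) * (y ^ b)) (freeRows-prepend true s F r) (freeCols-new-row s F r)))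
      (trans≈ (*-congʳ (^-+ x (bit (rowIsFree r)) (freeRows s F)))
              (solve 3 (λ p q z → (p :* q) :* z := q :* (p :* z)) refl≈ _ _ _))

  A-suc : ∀ n x y → A (suc n) x y ≈ (x + y) * A n x (1# + y)
  A-suc n x y = begin
    sumE (Σ-enum (tableau-enum n) Extension extension-enum) (λ p → weight x y (attach p))
      ≈⟨ sumE-Σ (tableau-enum n) Extension extension-enum (λ p → weight x y (attach p)) ⟩
    sumE (tableau-enum n) (λ T → sumE (extension-enum T) (λ e → weight x y (attach (T , e))))
      ≈⟨ sumE-cong (tableau-enum n) (λ T → trans≈ (extension-sum x y T)
           (solve 3 (λ p z q → p :* (z :* q) := z :* (p :* q)) refl≈ _ _ _)) ⟩
    sumE (tableau-enum n) (λ T → (x + y) * weight x (1# + y) T)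
      ≈⟨ sumE-*ˡ (tableau-enum n) (x + y) (weight x (1# + y)) ⟩
    (x + y) * A n x (1# + y) ∎

  A-product : ∀ n x y → A n x y ≈ ∏ (λ (i : Fin n) → (x + y) + ⟦ toℕ i ⟧)
  A-product zero    x y = trans≈ (+-identityʳ _) (*-identityʳ 1#)
  A-product (suc n) x y = begin
    A (suc n) x y
      ≈⟨ A-suc n x y ⟩
    (x + y) * A n x (1# + y)
      ≈⟨ *-congˡ (A-product n x (1# + y)) ⟩
    (x + y) * ∏ (λ (i : Fin n) → (x + (1# + y)) + ⟦ toℕ i ⟧)
      ≈⟨ *-cong (sym≈ (+-identityʳ _)) (∏-cong {n} (λ i →
           solve 4 (λ x o y k → (x :+ (o :+ y)) :+ k := (x :+ y) :+ (o :+ k)) refl≈ x 1# y ⟦ toℕ i ⟧)) ⟩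
    ((x + y) + 0#) * ∏ (λ (i : Fin n) → (x + y) + (1# + ⟦ toℕ i ⟧)) ∎


  fibre-sizes-product : ∀ n x y →
    ∑ (λ (i : Fin (suc n)) → ∑ (λ (j : Fin (suc n)) →
        ⟦ size (fibre-enum (tableau-enum n) freeRowsOf freeColsOf (toℕ i) (toℕ j)) ⟧ * ((x ^ toℕ i) * (y ^ toℕ j))))
    ≈ ∏ (λ (i : Fin n) → (x + y) + ⟦ toℕ i ⟧)
  fibre-sizes-product n x y =
    trans≈ (fibre-sizes-generate (tableau-enum n) n freeRowsOf freeColsOf
              (λ T → countFin-≤ _) (λ T → countFin-≤ _) x y)
           (A-product n x y)

corollary3p3 : (n : ℕ) →
  Σ (ℕ → ℕ → ℕ) λ card →
    ((i j : ℕ) → Fin (card i j) ↔ 𝒜 i j n) ×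
    ((R : CommutativeSemiring 0ℓ 0ℓ) →
      let open CommutativeSemiring R
          open SemiringOps R
      in ∀ (x y : Carrier) →
        ∑ (λ (i : Fin (suc n)) → ∑ (λ (j : Fin (suc n)) →
            ⟦ card (toℕ i) (toℕ j) ⟧ * ((x ^ toℕ i) * (y ^ toℕ j))))
        ≈ ∏ (λ (i : Fin n) → (x + y) + ⟦ toℕ i ⟧))
corollary3p3 n =
  (λ i j → size (fibres i j)) , (λ i j → elements (fibres i j)) , (λ R → GeneratingFunction.fibre-sizes-product R n)
  where
  -- 𝒜 i j n is the fibre of (free rows, free columns) over (i , j).
  fibres : ∀ i j → Enum (𝒜 i j n)
  fibres = fibre-enum (tableau-enum n) freeRowsOf freeColsOf
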